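{- Let $t \geq 3$ and let $p_1,\dots,p_t$ be distinct primes. For $n = p_1p_2\cdots p_t$, we have $i(X_n) \leq 4p_1p_2\cdots p_{t-3}$.
   Context: $X_n$ is the unitary Cayley graph of $\mathbb{Z}/n\mathbb{Z}$: vertex set $\{0,\dots,n-1\}$, with $a,b$ adjacent iff $\gcd(a-b,n)=1$. $i(G)$ is the minimum size of a maximal independent set of $G$. (An empty product, when $t=3$, equals $1$.) -}

module Defs where

open import Data.Nat using (ℕ; ∣_-_∣; _≤_; _∸_)
open import Data.Nat.GCD using (gcd)
open import Data.Nat.Primality using (Prime)
open import Data.Fin using (Fin; toℕ)
open import Data.Fin.Subset using (Subset; _∈_; _⊆_; ∣_∣)
open import Data.List using (List; take; length)
open import Data.Nat.ListAction using (product)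
open import Data.List.Relation.Unary.All using (All)
open import Data.List.Relation.Unary.AllPairs using (AllPairs)
open import Data.Product using (Σ; _×_)
open import Relation.Binary.PropositionalEquality using (_≡_; _≢_)
open import Relation.Nullary using (¬_)

-- Unitary Cayley graph X_n on Z/nZ, vertices 0..n-1 (as Fin n):
-- a ~ b iff gcd(a - b, n) = 1. For a, b < n, gcd(a-b, n) = gcd(|a-b|, n).
Adj : (n : ℕ) → Fin n → Fin n → Set
Adj n a b = gcd ∣ toℕ a - toℕ b ∣ n ≡ 1

Independent : (n : ℕ) → Subset n → Set
Independent n S = ∀ a b → a ∈ S → b ∈ S → ¬ Adj n a b

MaximalIndependent : (n : ℕ) → Subset n → Set
MaximalIndependent n S =
  Independent n S × (∀ T → S ⊆ T → Independent n T → T ⊆ S)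

-- i(X_n) ≤ k : the minimum size of a maximal independent set is at most k,
-- i.e. some maximal independent set has size at most k.
IndepDomLE : (n k : ℕ) → Set
IndepDomLE n k = Σ (Subset n) λ S → MaximalIndependent n S × ∣ S ∣ ≤ k

module Submission where

-- Write n = m·q·r·s with m = p₁⋯p_{t-3}, put ρ(x) = (x mod q, x mod r, x mod s)
-- and let P = {000, 011, 101, 110} be the 0/1 triples of even weight.  Then
-- S = {x : ρ(x) ∈ P} is independent, since two triples of P agree in some
-- coordinate; it is maximal, since for ρ(x) ∉ P some w ∈ P differs from ρ(x)
-- everywhere, and the Chinese remainder theorem gives y with ρ(y) = w and
-- y ≡ x + 1 (mod m), so that x − y is coprime to n; and |S| ≤ 4m, since S is
-- periodic modulo qrs and ρ is injective on [0, qrs).  The construction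
-- (module Construction) only uses that m is coprime to q, r, s.  It rests on
-- congruences and coprimality, the Chinese remainder theorem, counting on
-- initial segments of ℕ, the combinatorics of P and two general facts about
-- independent sets of X_n; the theorem is then a short corollary.

open import Defs
open import Data.Nat using (ℕ; zero; suc; _≤_; _<_; _*_; _+_; _∸_; ∣_-_∣;
  NonZero; z≤n; s≤s; _%_; _/_; nonTrivial⇒≢1; nonTrivial⇒n>1; ≢-nonZero⁻¹)
open import Data.Nat.Properties
open import Data.Nat.DivMod
open import Data.Nat.Divisibility
open import Data.Nat.Coprimality using (Coprime; coprime-divisor; coprime-Bézout; gcd≡1⇒coprime;
  coprime⇒gcd≡1) renaming (sym to ⊥-sym)
open import Data.Nat.GCD using (module Bézout)
open import Data.Nat.Primality using (Prime; prime⇒irreducible; prime⇒nonZero; prime⇒nonTrivial;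
  productOfPrimes≢0)
open import Data.Nat.Tactic.RingSolver using (solve-∀)
open import Data.Bool using (Bool; true; false; _∨_; T; if_then_else_)
open import Data.Bool.Properties using (T-≡)
open import Data.Fin using (Fin; toℕ; fromℕ<)
open import Data.Fin.Properties using (toℕ-fromℕ<)
open import Data.Fin.Subset using (Subset; _∈_; _∉_; _⊆_; ∣_∣)
open import Data.Fin.Subset.Properties using (_∈?_)
open import Data.Vec using (tabulate)
open import Data.Vec.Properties using (lookup∘tabulate; []=⇒lookup; lookup⇒[]=)
open import Data.List using (List; []; _∷_; _++_; take; drop; length)
open import Data.List.Properties using (length-drop; take++drop≡id)
open import Data.Nat.ListAction using (product)
open import Data.Nat.ListAction.Properties using (product-++)
open import Data.List.Relation.Unary.All using (All; []; _∷_; all?) renaming (lookup to All-lookup; map to All-map)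
open import Data.List.Relation.Unary.All.Properties using (++⁻; ++⁻ʳ)
open import Data.List.Relation.Unary.AllPairs using (AllPairs; []; _∷_)
open import Data.List.Relation.Unary.Any using (here; there)
open import Data.Product using (∃-syntax; _×_; _,_; proj₁; proj₂; map₂; swap)
open import Data.Product.Properties using (≡-dec)
open import Data.Sum using (_⊎_; inj₁; inj₂)
open import Data.Unit using (tt)
open import Data.Empty using (⊥-elim)
open import Function using (_∘_; Equivalence)
open import Relation.Nullary using (¬_; Dec; yes; no)
open import Relation.Nullary.Decidable using (⌊_⌋; toWitness; fromWitness; _⊎-dec_; _×-dec_)
open import Relation.Binary.Definitions using (DecidableEquality)
open import Relation.Binary.PropositionalEquality

-- Congruences, expressed as equal remainders

%≡⇒∣∣-∣ : ∀ x y d .{{_ : NonZero d}} → x % d ≡ y % d → d ∣ ∣ x - y ∣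
%≡⇒∣∣-∣ x y d eq = divides ∣ x / d - y / d ∣ (begin
    ∣ x - y ∣                                 ≡⟨ cong₂ ∣_-_∣ (m≡m%n+[m/n]*n x d) (m≡m%n+[m/n]*n y d) ⟩
    ∣ x % d + x / d * d - y % d + y / d * d ∣ ≡⟨ cong (λ z → ∣ x % d + x / d * d - z + y / d * d ∣) (sym eq) ⟩
    ∣ x % d + x / d * d - x % d + y / d * d ∣ ≡⟨ ∣m+n-m+o∣≡∣n-o∣ (x % d) _ _ ⟩
    ∣ x / d * d - y / d * d ∣                 ≡⟨ *-distribʳ-∣-∣ d (x / d) (y / d) ⟨
    ∣ x / d - y / d ∣ * d                     ∎)
  where open ≡-Reasoning

-- The converse, first for x ≤ y, where y = x + |x − y|.
∣∣-∣⇒%≡-≤ : ∀ {x y} d .{{_ : NonZero d}} → x ≤ y → d ∣ ∣ x - y ∣ → x % d ≡ y % d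
∣∣-∣⇒%≡-≤ {x} {y} d x≤y d∣ = begin
    x % d               ≡⟨ %-remove-+ʳ x d∣ ⟨
    (x + ∣ x - y ∣) % d ≡⟨ cong (λ z → (x + z) % d) (m≤n⇒∣m-n∣≡n∸m x≤y) ⟩
    (x + (y ∸ x)) % d   ≡⟨ cong (_% d) (m+[n∸m]≡n x≤y) ⟩
    y % d               ∎
  where open ≡-Reasoning

∣∣-∣⇒%≡ : ∀ x y d .{{_ : NonZero d}} → d ∣ ∣ x - y ∣ → x % d ≡ y % d
∣∣-∣⇒%≡ x y d d∣ with ≤-total x y
... | inj₁ x≤y = ∣∣-∣⇒%≡-≤ d x≤y d∣
... | inj₂ y≤x = sym (∣∣-∣⇒%≡-≤ d y≤x (subst (d ∣_) (∣-∣-comm x y) d∣))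

+-cong-% : ∀ a {b b′} d .{{_ : NonZero d}} → b % d ≡ b′ % d → (a + b) % d ≡ (a + b′) % d
+-cong-% a {b} {b′} d eq = begin
    (a + b) % d           ≡⟨ %-distribˡ-+ a b d ⟩
    (a % d + b % d) % d   ≡⟨ cong (λ z → (a % d + z) % d) eq ⟩
    (a % d + b′ % d) % d  ≡⟨ %-distribˡ-+ a b′ d ⟨
    (a + b′) % d          ∎
  where open ≡-Reasoning

*-cong-% : ∀ {a a′} b d .{{_ : NonZero d}} → a % d ≡ a′ % d → (a * b) % d ≡ (a′ * b) % d
*-cong-% {a} {a′} b d eq = begin
    (a * b) % d           ≡⟨ %-distribˡ-* a b d ⟩
    (a % d * (b % d)) % d  ≡⟨ cong (λ z → (z * (b % d)) % d) eq ⟩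
    (a′ % d * (b % d)) % d ≡⟨ %-distribˡ-* a′ b d ⟨
    (a′ * b) % d          ∎
  where open ≡-Reasoning

%-cong-∣ : ∀ {a d} x y .{{_ : NonZero a}} .{{_ : NonZero d}} → d ∣ a → x % a ≡ y % a → x % d ≡ y % d
%-cong-∣ {a} {d} x y d∣a eq = begin
    x % d     ≡⟨ m∣n⇒o%n%m≡o%m d a x d∣a ⟨
    x % a % d ≡⟨ cong (_% d) eq ⟩
    y % a % d ≡⟨ m∣n⇒o%n%m≡o%m d a y d∣a ⟩
    y % d     ∎
  where open ≡-Reasoning

coprime-*ʳ : ∀ {a b c} → Coprime a b → Coprime a c → Coprime a (b * c)
coprime-*ʳ {a} {b} a⊥b a⊥c (d∣a , d∣bc) = a⊥c (d∣a , coprime-divisor (d⊥b d∣a) d∣bc)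
  where
  d⊥b : ∀ {d} → d ∣ a → Coprime d b
  d⊥b d∣a (e∣d , e∣b) = a⊥b (∣-trans e∣d d∣a , e∣b)

coprime-*ˡ : ∀ {a b c} → Coprime a c → Coprime b c → Coprime (a * b) c
coprime-*ˡ a⊥c b⊥c = ⊥-sym (coprime-*ʳ (⊥-sym a⊥c) (⊥-sym b⊥c))

distinct-primes-coprime : ∀ {p q} → Prime p → Prime q → p ≢ q → Coprime p q
distinct-primes-coprime p-prime q-prime p≢q (d∣p , d∣q) with prime⇒irreducible p-prime d∣p
... | inj₁ d≡1 = d≡1
... | inj₂ refl with prime⇒irreducible q-prime d∣q
...   | inj₁ d≡1 = d≡1
...   | inj₂ d≡q = ⊥-elim (p≢q d≡q)

coprime-product : ∀ {p} xs → All Prime xs → Prime p → All (_≢ p) xs → Coprime (product xs) p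
coprime-product []       []             _       []             (d∣1 , _) = ∣1⇒≡1 d∣1
coprime-product (x ∷ xs) (x-prime ∷ ps) p-prime (x≢p ∷ x≢ps) =
  coprime-*ˡ (distinct-primes-coprime x-prime p-prime x≢p) (coprime-product xs ps p-prime x≢ps)

coprime-lcm : ∀ {a b c} → Coprime a b → a ∣ c → b ∣ c → a * b ∣ c
coprime-lcm {a} {b} a⊥b a∣c (divides k refl) with coprime-divisor a⊥b (subst (a ∣_) (*-comm k b) a∣c)
... | divides j refl = divides j (*-assoc j a b)

-- If y ≡ x + 1 (mod m), a common divisor of x − y and m divides x + 1 − x.
consecutive⇒coprime : ∀ x y m .{{_ : NonZero m}} → y % m ≡ suc x % m → Coprime ∣ x - y ∣ m
consecutive⇒coprime x y m _ {zero} (_ , 0∣m) = ⊥-elim (≢-nonZero⁻¹ m (0∣⇒≡0 0∣m))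
consecutive⇒coprime x y m y≡x+1 {d@(suc _)} (d∣x-y , d∣m) =
  ∣1⇒≡1 (subst (d ∣_) distance≡1 (%≡⇒∣∣-∣ x (suc x) d x≡x+1))
  where
  open ≡-Reasoning
  distance≡1 : ∣ x - suc x ∣ ≡ 1
  distance≡1 = trans (cong (λ z → ∣ x - z ∣) (+-comm 1 x)) (∣m-m+n∣≡n x 1)
  x≡x+1 : x % d ≡ suc x % d
  x≡x+1 = begin
    x % d     ≡⟨ ∣∣-∣⇒%≡ x y d d∣x-y ⟩
    y % d     ≡⟨ %-cong-∣ y (suc x) d∣m y≡x+1 ⟩
    suc x % d ∎

incongruent⇒coprime : ∀ x y {p} .{{_ : NonZero p}} → Prime p → x % p ≢ y % p → Coprime ∣ x - y ∣ p
incongruent⇒coprime x y p-prime x≢y {d} (d∣x-y , d∣p) with prime⇒irreducible p-prime d∣p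
... | inj₁ d≡1 = d≡1
... | inj₂ refl = ⊥-elim (x≢y (∣∣-∣⇒%≡ x y d d∣x-y))

-- The Chinese remainder theorem for two coprime moduli

bézout⇒inverse : ∀ {a b u y} .{{_ : NonZero b}} → 1 + y * b ≡ u * a → (u * a) % b ≡ 1 % b
bézout⇒inverse {b = b} {y = y} eq = trans (cong (_% b) (sym eq)) ([m+kn]%n≡m%n 1 y b)

crt-rearrange : ∀ i j b′ → i + 1 * (j + b′ * i) ≡ j + i * suc b′
crt-rearrange = solve-∀

-- With such an inverse, k = i + u·a·(j + (b − 1)·i) solves k ≡ i (mod a), k ≡ j (mod b).
crt-inverse : ∀ {a b} u .{{_ : NonZero a}} .{{_ : NonZero b}} → (u * a) % b ≡ 1 % b →
  ∀ i j → ∃[ k ] (k % a ≡ i % a × k % b ≡ j % b)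
crt-inverse {a} {b@(suc b′)} u inverse i j = k , k≡i , k≡j
  where
  open ≡-Reasoning
  c : ℕ
  c = j + b′ * i
  k : ℕ
  k = i + u * a * c
  k≡i : k % a ≡ i % a
  k≡i = %-remove-+ʳ i (∣m⇒∣m*n c (n∣m*n u))
  k≡j : k % b ≡ j % b
  k≡j = begin
    (i + u * a * c) % b ≡⟨ +-cong-% i b (*-cong-% {u * a} {1} c b inverse) ⟩
    (i + 1 * c) % b     ≡⟨ cong (_% b) (crt-rearrange i j b′) ⟩
    (j + i * b) % b     ≡⟨ [m+kn]%n≡m%n j i b ⟩
    j % b               ∎

-- The Chinese remainder theorem: congruences modulo coprime a and b have a
-- common solution; Bézout provides an inverse of a mod b or of b mod a.
crt : ∀ {a b} .{{_ : NonZero a}} .{{_ : NonZero b}} → Coprime a b →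
  ∀ i j → ∃[ k ] (k % a ≡ i % a × k % b ≡ j % b)
crt {a} {b} a⊥b i j with coprime-Bézout a⊥b
... | Bézout.+- u y eq = crt-inverse u (bézout⇒inverse {a} {b} {u} {y} eq) i j
... | Bézout.-+ y u eq = map₂ swap (crt-inverse u (bézout⇒inverse {b} {a} {u} {y} eq) j i)

-- Counting the points below N that satisfy a Boolean test

count : (ℕ → Bool) → ℕ → ℕ
count B zero    = 0
count B (suc N) = (if B 0 then 1 else 0) + count (B ∘ suc) N

count-tabulate : ∀ N (B : ℕ → Bool) → ∣ tabulate {n = N} (B ∘ toℕ) ∣ ≡ count B N
count-tabulate zero    B = refl
count-tabulate (suc N) B with B 0
... | true  = cong suc (count-tabulate N (B ∘ suc))
... | false = count-tabulate N (B ∘ suc)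

count-cong : ∀ N {B C : ℕ → Bool} → (∀ i → B i ≡ C i) → count B N ≡ count C N
count-cong zero    B≡C = refl
count-cong (suc N) B≡C = cong₂ _+_ (cong (λ b → if b then 1 else 0) (B≡C 0)) (count-cong N (B≡C ∘ suc))

count-+ : ∀ a N (B : ℕ → Bool) → count B (a + N) ≡ count B a + count (λ i → B (a + i)) N
count-+ zero    N B = refl
count-+ (suc a) N B = trans (cong ((if B 0 then 1 else 0) +_) (count-+ a N (B ∘ suc)))
  (sym (+-assoc (if B 0 then 1 else 0) _ _))

count-periodic : ∀ Q (B : ℕ → Bool) → (∀ i → B (Q + i) ≡ B i) → ∀ k → count B (k * Q) ≡ k * count B Q
count-periodic Q B periodic zero    = refl
count-periodic Q B periodic (suc k) = begin
    count B (Q + k * Q)                         ≡⟨ count-+ Q (k * Q) B ⟩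
    count B Q + count (λ i → B (Q + i)) (k * Q) ≡⟨ cong (count B Q +_) (count-cong (k * Q) periodic) ⟩
    count B Q + count B (k * Q)                 ≡⟨ cong (count B Q +_) (count-periodic Q B periodic k) ⟩
    count B Q + k * count B Q                   ∎
  where open ≡-Reasoning

count-∨ : ∀ N (B C : ℕ → Bool) → count (λ i → B i ∨ C i) N ≤ count B N + count C N
count-∨ zero    B C = z≤n
count-∨ (suc N) B C with B 0 | C 0 | count-∨ N (B ∘ suc) (C ∘ suc)
... | true  | true  | ih = s≤s (≤-trans ih (+-monoʳ-≤ (count (B ∘ suc) N) (n≤1+n _)))
... | true  | false | ih = s≤s ih
... | false | true  | ih = ≤-trans (s≤s ih) (≤-reflexive (sym (+-suc (count (B ∘ suc) N) _)))
... | false | false | ih = ih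

count-none : ∀ N (B : ℕ → Bool) → (∀ i → i < N → ¬ T (B i)) → count B N ≡ 0
count-none zero    B none = refl
count-none (suc N) B none with B 0 in B0
... | true  = ⊥-elim (none 0 (s≤s z≤n) (subst T (sym B0) tt))
... | false = count-none N (B ∘ suc) (λ i i<N → none (suc i) (s≤s i<N))

count-unique : ∀ N (B : ℕ → Bool) → (∀ i j → i < N → j < N → T (B i) → T (B j) → i ≡ j) → count B N ≤ 1
count-unique zero    B unique = z≤n
count-unique (suc N) B unique with B 0 in B0
... | true  = ≤-reflexive (cong suc (count-none N (B ∘ suc) (λ i i<N Bi →
                0≢1+n (unique 0 (suc i) (s≤s z≤n) (s≤s i<N) (subst T (sym B0) tt) Bi))))
... | false = count-unique N (B ∘ suc) (λ i j i<N j<N Bi Bj →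
                suc-injective (unique (suc i) (suc j) (s≤s i<N) (s≤s j<N) Bi Bj))

module Preimage {A : Set} (_≟ᴬ_ : DecidableEquality A) where
  open import Data.List.Membership.DecPropositional _≟ᴬ_ using () renaming (_∈?_ to _∈ₗ?_)

  ∈?-∷ : ∀ x w W → ⌊ x ∈ₗ? (w ∷ W) ⌋ ≡ (⌊ x ≟ᴬ w ⌋ ∨ ⌊ x ∈ₗ? W ⌋)
  ∈?-∷ x w W with x ≟ᴬ w | x ∈ₗ? W
  ... | yes _ | _     = refl
  ... | no _  | yes _ = refl
  ... | no _  | no _  = refl

  count-preimage : ∀ N (f : ℕ → A) → (∀ i j → i < N → j < N → f i ≡ f j → i ≡ j) →
    ∀ W → count (λ i → ⌊ f i ∈ₗ? W ⌋) N ≤ length W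
  count-preimage N f injective []      = ≤-reflexive (count-none N _ (λ _ _ ()))
  count-preimage N f injective (w ∷ W) = begin
      count (λ i → ⌊ f i ∈ₗ? (w ∷ W) ⌋) N                       ≡⟨ count-cong N (λ i → ∈?-∷ (f i) w W) ⟩
      count (λ i → ⌊ f i ≟ᴬ w ⌋ ∨ ⌊ f i ∈ₗ? W ⌋) N               ≤⟨ count-∨ N _ _ ⟩
      count (λ i → ⌊ f i ≟ᴬ w ⌋) N + count (λ i → ⌊ f i ∈ₗ? W ⌋) N ≤⟨ +-mono-≤ fibre (count-preimage N f injective W) ⟩
      1 + length W                                             ∎
    where
    open ≤-Reasoning
    fibre : count (λ i → ⌊ f i ≟ᴬ w ⌋) N ≤ 1
    fibre = count-unique N _ (λ i j i<N j<N fi≡w fj≡w →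
      injective i j i<N j<N (trans (toWitness fi≡w) (sym (toWitness fj≡w))))

-- The four residue patterns

Triple : Set
Triple = ℕ × ℕ × ℕ

_≟₃_ : DecidableEquality Triple
_≟₃_ = ≡-dec _≟_ (≡-dec _≟_ _≟_)

open import Data.List.Membership.DecPropositional _≟₃_ using () renaming (_∈?_ to _∈ₗ?_; _∈_ to _∈ₗ_; _∉_ to _∉ₗ_)
open Preimage _≟₃_ using (count-preimage)

patterns : List Triple
patterns = (0 , 0 , 0) ∷ (0 , 1 , 1) ∷ (1 , 0 , 1) ∷ (1 , 1 , 0) ∷ []

Meet : Triple → Triple → Set
Meet (a , b , c) (a′ , b′ , c′) = a ≡ a′ ⊎ b ≡ b′ ⊎ c ≡ c′

meet? : ∀ u v → Dec (Meet u v)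
meet? (a , b , c) (a′ , b′ , c′) = (a ≟ a′) ⊎-dec (b ≟ b′) ⊎-dec (c ≟ c′)

Avoid : Triple → Triple → Set
Avoid (a , b , c) (a′ , b′ , c′) = a ≢ a′ × b ≢ b′ × c ≢ c′

Bits : Triple → Set
Bits (a , b , c) = a < 2 × b < 2 × c < 2

bits? : ∀ v → Dec (Bits v)
bits? (a , b , c) = (a <? 2) ×-dec (b <? 2) ×-dec (c <? 2)

patterns-bits : ∀ {w} → w ∈ₗ patterns → Bits w
patterns-bits = All-lookup (toWitness {a? = all? bits? patterns} tt)

patterns-meet : ∀ {u v} → u ∈ₗ patterns → v ∈ₗ patterns → Meet u v
patterns-meet u∈ v∈ = All-lookup (All-lookup pairwise u∈) v∈
  where
  pairwise : All (λ u → All (Meet u) patterns) patterns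
  pairwise = toWitness {a? = all? (λ u → all? (meet? u) patterns) patterns} tt

p000 : (0 , 0 , 0) ∈ₗ patterns
p000 = here refl
p011 : (0 , 1 , 1) ∈ₗ patterns
p011 = there (here refl)
p101 : (1 , 0 , 1) ∈ₗ patterns
p101 = there (there (here refl))
p110 : (1 , 1 , 0) ∈ₗ patterns
p110 = there (there (there (here refl)))

escape : ∀ v → v ∉ₗ patterns → ∃[ w ] (w ∈ₗ patterns × Avoid w v)
escape (suc a , suc b , suc c)       _  = _ , p000 , (λ ()) , (λ ()) , (λ ())
escape (0 , 0 , 0)                   v∉ = ⊥-elim (v∉ p000)
escape (0 , 0 , suc c)               _  = _ , p110 , (λ ()) , (λ ()) , (λ ())
escape (0 , 1 , 0)                   _  = _ , p101 , (λ ()) , (λ ()) , (λ ())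
escape (0 , 1 , 1)                   v∉ = ⊥-elim (v∉ p011)
escape (0 , 1 , suc (suc c))         _  = _ , p101 , (λ ()) , (λ ()) , (λ ())
escape (0 , suc (suc b) , 0)         _  = _ , p101 , (λ ()) , (λ ()) , (λ ())
escape (0 , suc (suc b) , suc c)     _  = _ , p110 , (λ ()) , (λ ()) , (λ ())
escape (suc a , 0 , 0)               _  = _ , p011 , (λ ()) , (λ ()) , (λ ())
escape (1 , 0 , 1)                   v∉ = ⊥-elim (v∉ p101)
escape (suc (suc a) , 0 , 1)         _  = _ , p110 , (λ ()) , (λ ()) , (λ ())
escape (suc a , 0 , suc (suc c))     _  = _ , p011 , (λ ()) , (λ ()) , (λ ())
escape (1 , 1 , 0)                   v∉ = ⊥-elim (v∉ p110)
escape (1 , suc (suc b) , 0)         _  = _ , p011 , (λ ()) , (λ ()) , (λ ())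
escape (suc (suc a) , suc b , 0)     _  = _ , p101 , (λ ()) , (λ ()) , (λ ())

-- Independent sets of X_n

congruent⇒¬adj : ∀ {n p} .{{_ : NonZero p}} (a b : Fin n) → Prime p → p ∣ n →
  toℕ a % p ≡ toℕ b % p → ¬ Adj n a b
congruent⇒¬adj a b p-prime p∣n a≡b adj =
  nonTrivial⇒≢1 {{prime⇒nonTrivial p-prime}} (gcd≡1⇒coprime adj (%≡⇒∣∣-∣ (toℕ a) (toℕ b) _ a≡b , p∣n))

dominating⇒maximal : ∀ {n} (S : Subset n) → Independent n S →
  (∀ x → x ∉ S → ∃[ y ] (y ∈ S × Adj n x y)) → MaximalIndependent n S
dominating⇒maximal {n} S independent dominating = independent , maximal
  where
  maximal : ∀ T → S ⊆ T → Independent n T → T ⊆ S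
  maximal T S⊆T T-independent {x} x∈T with x ∈? S
  ... | yes x∈S = x∈S
  ... | no x∉S with dominating x x∉S
  ...   | y , y∈S , x~y = ⊥-elim (T-independent x y x∈T (S⊆T y∈S) x~y)

∈-tabulate⁺ : ∀ {n} (f : Fin n → Bool) {x} → T (f x) → x ∈ tabulate f
∈-tabulate⁺ f {x} fx = lookup⇒[]= x (tabulate f) (trans (lookup∘tabulate f x) (Equivalence.to T-≡ fx))

∈-tabulate⁻ : ∀ {n} (f : Fin n → Bool) {x} → x ∈ tabulate f → T (f x)
∈-tabulate⁻ f {x} x∈ = Equivalence.from T-≡ (trans (sym (lookup∘tabulate f x)) ([]=⇒lookup x∈))

-- The construction, for n = m·q·r·s with q, r, s distinct primes coprime to m

module Construction (m q r s : ℕ) .{{_ : NonZero m}}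
  (q-prime : Prime q) (r-prime : Prime r) (s-prime : Prime s)
  (q≢r : q ≢ r) (q≢s : q ≢ s) (r≢s : r ≢ s)
  (m⊥q : Coprime m q) (m⊥r : Coprime m r) (m⊥s : Coprime m s) where

  Q : ℕ
  Q = q * r * s

  n : ℕ
  n = m * Q

  instance
    q≢0 : NonZero q
    q≢0 = prime⇒nonZero q-prime
    r≢0 : NonZero r
    r≢0 = prime⇒nonZero r-prime
    s≢0 : NonZero s
    s≢0 = prime⇒nonZero s-prime
    qr≢0 : NonZero (q * r)
    qr≢0 = m*n≢0 q r
    Q≢0 : NonZero Q
    Q≢0 = m*n≢0 (q * r) s
    n≢0 : NonZero n
    n≢0 = m*n≢0 m Q

  q⊥r : Coprime q r
  q⊥r = distinct-primes-coprime q-prime r-prime q≢r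

  qr⊥s : Coprime (q * r) s
  qr⊥s = coprime-*ˡ (distinct-primes-coprime q-prime s-prime q≢s) (distinct-primes-coprime r-prime s-prime r≢s)

  m⊥Q : Coprime m Q
  m⊥Q = coprime-*ʳ (coprime-*ʳ m⊥q m⊥r) m⊥s

  q∣Q : q ∣ Q
  q∣Q = ∣m⇒∣m*n s (m∣m*n r)

  r∣Q : r ∣ Q
  r∣Q = ∣m⇒∣m*n s (n∣m*n q)

  s∣Q : s ∣ Q
  s∣Q = n∣m*n (q * r)

  Q∣n : Q ∣ n
  Q∣n = n∣m*n m

  ρ : ℕ → Triple
  ρ x = x % q , x % r , x % s

  ρ-cong : ∀ x y → x % Q ≡ y % Q → ρ x ≡ ρ y
  ρ-cong x y x≡y = cong₂ _,_ (%-cong-∣ x y q∣Q x≡y) (cong₂ _,_ (%-cong-∣ x y r∣Q x≡y) (%-cong-∣ x y s∣Q x≡y))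

  ρ-injective : ∀ x y → ρ x ≡ ρ y → x % Q ≡ y % Q
  ρ-injective x y ρx≡ρy = ∣∣-∣⇒%≡ x y Q (coprime-lcm qr⊥s (coprime-lcm q⊥r (p∣x-y (cong proj₁ ρx≡ρy))
      (p∣x-y (cong (proj₁ ∘ proj₂) ρx≡ρy))) (p∣x-y (cong (proj₂ ∘ proj₂) ρx≡ρy)))
    where
    p∣x-y : ∀ {p} .{{_ : NonZero p}} → x % p ≡ y % p → p ∣ ∣ x - y ∣
    p∣x-y = %≡⇒∣∣-∣ x y _

  ρ-surjective : ∀ a b c → ∃[ z ] ρ z ≡ (a % q , b % r , c % s)
  ρ-surjective a b c with crt q⊥r a b
  ... | z₁ , z₁≡a , z₁≡b with crt qr⊥s z₁ c
  ...   | z , z≡z₁ , z≡c = z , cong₂ _,_ (trans (%-cong-∣ z z₁ (m∣m*n {q} r) z≡z₁) z₁≡a)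
                                         (cong₂ _,_ (trans (%-cong-∣ z z₁ (n∣m*n q {r}) z≡z₁) z₁≡b) z≡c)

  inS : ℕ → Bool
  inS x = ⌊ ρ x ∈ₗ? patterns ⌋

  S : Subset n
  S = tabulate (inS ∘ toℕ)

  ∈S⁺ : ∀ {x} → ρ (toℕ x) ∈ₗ patterns → x ∈ S
  ∈S⁺ ρx∈ = ∈-tabulate⁺ (inS ∘ toℕ) (fromWitness ρx∈)

  ∈S⁻ : ∀ {x} → x ∈ S → ρ (toℕ x) ∈ₗ patterns
  ∈S⁻ x∈ = toWitness (∈-tabulate⁻ (inS ∘ toℕ) x∈)

  -- Two patterns meet, so elements of S are congruent modulo q, r or s.
  independent : Independent n S
  independent a b a∈S b∈S with patterns-meet (∈S⁻ a∈S) (∈S⁻ b∈S)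
  ... | inj₁ a≡b        = congruent⇒¬adj a b q-prime (∣-trans q∣Q Q∣n) a≡b
  ... | inj₂ (inj₁ a≡b) = congruent⇒¬adj a b r-prime (∣-trans r∣Q Q∣n) a≡b
  ... | inj₂ (inj₂ a≡b) = congruent⇒¬adj a b s-prime (∣-trans s∣Q Q∣n) a≡b

  -- Every pattern is attained, the entries of a pattern being below each prime.
  pattern-point : ∀ {w} → w ∈ₗ patterns → ∃[ z ] ρ z ≡ w
  pattern-point {a , b , c} w∈ =
    let a<2 , b<2 , c<2 = patterns-bits w∈
        z , ρz≡abc      = ρ-surjective a b c
    in z , trans ρz≡abc (cong₂ _,_ (bit% a<2 q-prime) (cong₂ _,_ (bit% b<2 r-prime) (bit% c<2 s-prime)))
    where
    bit% : ∀ {e p} → e < 2 → Prime p → .{{_ : NonZero p}} → e % p ≡ e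
    bit% e<2 p-prime = m<n⇒m%n≡m (<-≤-trans e<2 (nonTrivial⇒n>1 _ {{prime⇒nonTrivial p-prime}}))

  realise : ∀ x {w} → w ∈ₗ patterns → ∃[ y ] (y < n × y % m ≡ suc x % m × ρ y ≡ w)
  realise x w∈ =
    let z , ρz≡w        = pattern-point w∈
        k , k≡x+1 , k≡z = crt m⊥Q (suc x) z
    in k % n , m%n<n k n , trans (m∣n⇒o%n%m≡o%m m n k (m∣m*n Q)) k≡x+1 ,
       trans (ρ-cong (k % n) z (trans (m∣n⇒o%n%m≡o%m Q n k Q∣n) k≡z)) ρz≡w

  coprime-to-n : ∀ x y → y % m ≡ suc x % m → Avoid (ρ y) (ρ x) → Coprime ∣ x - y ∣ n
  coprime-to-n x y y≡x+1 (q≢ , r≢ , s≢) =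
    coprime-*ʳ (consecutive⇒coprime x y m y≡x+1)
      (coprime-*ʳ (coprime-*ʳ (incongruent⇒coprime x y q-prime (q≢ ∘ sym))
                              (incongruent⇒coprime x y r-prime (r≢ ∘ sym)))
                  (incongruent⇒coprime x y s-prime (s≢ ∘ sym)))

  neighbour : ∀ x {w} → w ∈ₗ patterns → Avoid w (ρ (toℕ x)) →
    ∃[ y ] (y < n × y % m ≡ suc (toℕ x) % m × ρ y ≡ w) → ∃[ y ] (y ∈ S × Adj n x y)
  neighbour x w∈ w-avoids (y , y<n , y≡x+1 , refl) = fromℕ< y<n , y∈S , coprime⇒gcd≡1 x-y-coprime
    where
    toℕ-y : toℕ (fromℕ< y<n) ≡ y
    toℕ-y = toℕ-fromℕ< y<n
    y∈S : fromℕ< y<n ∈ S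
    y∈S = ∈S⁺ (subst (λ z → ρ z ∈ₗ patterns) (sym toℕ-y) w∈)
    x-y-coprime : Coprime ∣ toℕ x - toℕ (fromℕ< y<n) ∣ n
    x-y-coprime = subst (λ z → Coprime ∣ toℕ x - z ∣ n) (sym toℕ-y) (coprime-to-n (toℕ x) y y≡x+1 w-avoids)

  dominating : ∀ x → x ∉ S → ∃[ y ] (y ∈ S × Adj n x y)
  dominating x x∉S with escape (ρ (toℕ x)) (x∉S ∘ ∈S⁺)
  ... | w , w∈ , w-avoids = neighbour x w∈ w-avoids (realise (toℕ x) w∈)

  inS-periodic : ∀ i → inS (Q + i) ≡ inS i
  inS-periodic i = cong (λ v → ⌊ v ∈ₗ? patterns ⌋) (ρ-cong (Q + i) i (%-remove-+ˡ {Q} i ∣-refl))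

  inS-period : count inS Q ≤ 4
  inS-period = count-preimage Q ρ injective patterns
    where
    injective : ∀ i j → i < Q → j < Q → ρ i ≡ ρ j → i ≡ j
    injective i j i<Q j<Q ρi≡ρj =
      trans (sym (m<n⇒m%n≡m i<Q)) (trans (ρ-injective i j ρi≡ρj) (m<n⇒m%n≡m j<Q))

  size : ∣ S ∣ ≤ 4 * m
  size = begin
    ∣ S ∣             ≡⟨ count-tabulate n inS ⟩
    count inS (m * Q) ≡⟨ count-periodic Q inS inS-periodic m ⟩
    m * count inS Q   ≤⟨ *-monoʳ-≤ m inS-period ⟩
    m * 4             ≡⟨ *-comm m 4 ⟩
    4 * m             ∎
    where open ≤-Reasoning

  small-maximal-independent-set : IndepDomLE n (4 * m)
  small-maximal-independent-set = S , dominating⇒maximal S independent dominating , size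

AllPairs-++⁻ : ∀ {A : Set} {R : A → A → Set} xs {ys} → AllPairs R (xs ++ ys) →
  All (λ x → All (R x) ys) xs × AllPairs R ys
AllPairs-++⁻ []       Rys          = [] , Rys
AllPairs-++⁻ (x ∷ xs) (Rx ∷ Rxsys) =
  let Rxs-ys , Rys = AllPairs-++⁻ xs Rxsys in (++⁻ʳ xs Rx ∷ Rxs-ys) , Rys

last-three : ∀ {A : Set} (xs : List A) → 3 ≤ length xs →
  ∃[ q ] ∃[ r ] ∃[ s ] drop (length xs ∸ 3) xs ≡ q ∷ r ∷ s ∷ []
last-three {A} xs 3≤len = length≡3 (trans (length-drop (length xs ∸ 3) xs) (m∸[m∸n]≡n 3≤len))
  where
  length≡3 : ∀ {ys : List A} → length ys ≡ 3 → ∃[ q ] ∃[ r ] ∃[ s ] ys ≡ q ∷ r ∷ s ∷ []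
  length≡3 {q ∷ r ∷ s ∷ []} refl = q , r , s , refl

-- product (q ∷ r ∷ s ∷ []) unfolds to q * (r * (s * 1)).
product-three : ∀ q r s → q * (r * (s * 1)) ≡ q * r * s
product-three = solve-∀

theorem-split : ∀ pre q r s → All Prime (pre ++ q ∷ r ∷ s ∷ []) → AllPairs _≢_ (pre ++ q ∷ r ∷ s ∷ []) →
  IndepDomLE (product (pre ++ q ∷ r ∷ s ∷ [])) (4 * product pre)
theorem-split pre q r s primes distinct with ++⁻ pre primes | AllPairs-++⁻ pre distinct
... | pre-primes , (q-prime ∷ r-prime ∷ s-prime ∷ []) | pre≢ , ((q≢r ∷ q≢s ∷ []) ∷ (r≢s ∷ []) ∷ [] ∷ []) =
  subst (λ k → IndepDomLE k (4 * m)) (sym n≡m*qrs)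
    (Construction.small-maximal-independent-set m q r s q-prime r-prime s-prime q≢r q≢s r≢s
      (m⊥ q-prime (All-map (λ { (x≢q ∷ _) → x≢q }) pre≢))
      (m⊥ r-prime (All-map (λ { (_ ∷ x≢r ∷ _) → x≢r }) pre≢))
      (m⊥ s-prime (All-map (λ { (_ ∷ _ ∷ x≢s ∷ _) → x≢s }) pre≢)))
  where
  m : ℕ
  m = product pre
  instance
    m≢0 : NonZero m
    m≢0 = productOfPrimes≢0 pre-primes
  m⊥ : ∀ {p} → Prime p → All (_≢ p) pre → Coprime m p
  m⊥ = coprime-product pre pre-primes
  n≡m*qrs : product (pre ++ q ∷ r ∷ s ∷ []) ≡ m * (q * r * s)
  n≡m*qrs = trans (product-++ pre (q ∷ r ∷ s ∷ [])) (cong (m *_) (product-three q r s))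

theorem4p10 : (ps : List ℕ) → 3 ≤ length ps → All Prime ps → AllPairs _≢_ ps →
    IndepDomLE (product ps) (4 * product (take (length ps ∸ 3) ps))
theorem4p10 ps 3≤t primes distinct with last-three ps 3≤t
... | q , r , s , last≡qrs =
  subst (λ xs → IndepDomLE (product xs) (4 * product pre)) split≡
    (theorem-split pre q r s (subst (All Prime) (sym split≡) primes) (subst (AllPairs _≢_) (sym split≡) distinct))
  where
  pre : List ℕ
  pre = take (length ps ∸ 3) ps
  split≡ : pre ++ q ∷ r ∷ s ∷ [] ≡ ps
  split≡ = trans (cong (pre ++_) (sym last≡qrs)) (take++drop≡id (length ps ∸ 3) ps)
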